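{- Let $R$ be a commutative ring with identity such that $4 \leq \gamma_t(\Gamma(R)) < \infty$. Then $\gamma(\Gamma(R)) = \gamma_t(\Gamma(R))$.
   Context: For a commutative ring $R$ with identity, $Z(R)$ denotes its set of zero-divisors and $Z(R)^* = Z(R)\setminus\{0\}$. The zero-divisor graph $\Gamma(R)$ has vertex set $Z(R)^*$; distinct vertices $r,s$ are adjacent iff $rs=0$, and a vertex $x$ is regarded as adjacent to itself iff $x^2=0$. A set $X \subseteq Z(R)^*$ is a dominating set if every vertex not in $X$ is adjacent to some element of $X$; it is a total dominating set if every vertex $v$ (including those in $X$) is adjacent to some $x \in X$ (with $x=v$ allowed only when $v^2=0$). $\gamma(\Gamma(R))$ and $\gamma_t(\Gamma(R))$ denote the minimum cardinalities of a dominating set and a total dominating set, respectively. -}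

module Defs where

open import Level using (Level; _⊔_)
open import Algebra.Bundles using (CommutativeRing)
open import Data.Nat using (ℕ; _≤_)
open import Data.List using (List; length)
open import Data.List.Relation.Unary.All using (All)
open import Data.List.Relation.Unary.Any using (Any)
open import Data.Product using (Σ; ∃; _×_)
open import Data.Sum using (_⊎_)
open import Relation.Nullary using (¬_)
open import Relation.Binary.PropositionalEquality using (_≡_)
import Data.List.Membership.Setoid as SetoidMem
import Data.List.Relation.Unary.Unique.Setoid as SetoidUnique

module ZeroDivisorGraph {c ℓ : Level} (R : CommutativeRing c ℓ) where
  open CommutativeRing R

  IsVertex : Carrier → Set (c ⊔ ℓ)
  IsVertex x = (¬ (x ≈ 0#)) × (∃ λ y → (¬ (y ≈ 0#)) × (x * y ≈ 0#))

  -- adjacency in Γ(R) (including the loop convention: v adjacent to itself iff v² = 0)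
  Adj : Carrier → Carrier → Set ℓ
  Adj v x = v * x ≈ 0#

  open SetoidMem setoid using (_∈_)

  -- a finite set of vertices, represented as a duplicate-free list (w.r.t. ≈)
  VertexSet : List Carrier → Set (c ⊔ ℓ)
  VertexSet X = All IsVertex X × SetoidUnique.Unique setoid X

  Dominating : List Carrier → Set (c ⊔ ℓ)
  Dominating X = All IsVertex X ×
    (∀ v → IsVertex v → (v ∈ X) ⊎ Any (Adj v) X)

  TotalDominating : List Carrier → Set (c ⊔ ℓ)
  TotalDominating X = All IsVertex X × (∀ v → IsVertex v → Any (Adj v) X)

  -- γ(Γ(R)) = n  (finite): there is a dominating set of cardinality n, and every
  -- finite dominating set has cardinality ≥ n (infinite ones trivially do)
  DominationNumberIs : ℕ → Set (c ⊔ ℓ)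
  DominationNumberIs n =
    (∃ λ X → VertexSet X × Dominating X × length X ≡ n) ×
    (∀ X → Dominating X → n ≤ length X)

  TotalDominationNumberIs : ℕ → Set (c ⊔ ℓ)
  TotalDominationNumberIs n =
    (∃ λ X → VertexSet X × TotalDominating X × length X ≡ n) ×
    (∀ X → TotalDominating X → n ≤ length X)

{-# OPTIONS --safe #-}
-- For vertices x, e of Γ(R) there are adjacent vertices p, q whose open
-- neighbourhoods cover the closed neighbourhoods of x and e: (x, e) itself if
-- xe = 0, and otherwise products of x, e and their annihilators.  Keeping q and
-- feeding p back in with the remaining vertices (N(p) ⊆ N[p]) turns a dominating
-- set of size ≥ 2 into a total dominating set of the same size, and {x} gives
-- the total dominating set {x, a} with xa = 0.  Hence γ ≥ γ_t once γ_t > 2.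
-- The case splits on products being zero are classical, which is harmless
-- because the conclusion n ≤ |X| is decidable.
module Submission where

open import Defs
open import Level using (Level) renaming (_⊔_ to _⊔ˡ_)
open import Algebra.Bundles using (CommutativeRing)
open import Data.Nat using (ℕ; suc; z≤n; _≤_; _<_; _⊔_; _≤?_)
open import Data.Nat.Properties using (⊔-sel; <⇒≱; ≤-refl; ≤-reflexive; ≤-trans; n≤1+n)
open import Data.List using (List; []; _∷_; length)
open import Data.List.Relation.Unary.All using (All; []; _∷_)
open import Data.List.Relation.Unary.Any using (Any; here; there)
import Data.List.Relation.Unary.Any as Any
import Data.List.Relation.Unary.Any.Properties as Any
open import Data.Product using (∃; _×_; _,_)
open import Function using (id; _∘_)
open import Data.Sum using (_⊎_; inj₁; inj₂)
import Data.Sum as Sum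
open import Relation.Nullary using (¬_; Dec; yes; no; contradiction)
open import Relation.Nullary.Decidable using (decidable-stable; ¬¬-excluded-middle)
open import Relation.Nullary.Negation using (¬¬-map; negated-stable)
open import Relation.Unary using (Pred; _⊆_)
open import Relation.Binary.PropositionalEquality using (_≡_; refl; cong; subst)

private
  _>>=_ : ∀ {a b} {A : Set a} {B : Set b} → ¬ ¬ A → (A → ¬ ¬ B) → ¬ ¬ B
  m >>= f = negated-stable (¬¬-map f m)

  return : ∀ {a} {A : Set a} → A → ¬ ¬ A
  return = contradiction

m≤n⊔o∧n<m⇒m≤o : ∀ {m} n o → m ≤ n ⊔ o → n < m → m ≤ o
m≤n⊔o∧n<m⇒m≤o {m} n o m≤n⊔o n<m with ⊔-sel n o
... | inj₁ n⊔o≡n = contradiction (subst (m ≤_) n⊔o≡n m≤n⊔o) (<⇒≱ n<m)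
... | inj₂ n⊔o≡o = subst (m ≤_) n⊔o≡o m≤n⊔o

module _ {c ℓ : Level} (R : CommutativeRing c ℓ) where
  open CommutativeRing R hiding (refl)
  open ZeroDivisorGraph R

  adj-respˡ : ∀ {v x y} → v ≈ x → Adj x y → Adj v y
  adj-respˡ v≈x xy = trans (*-congʳ v≈x) xy

  adj-sym : ∀ {x y} → Adj x y → Adj y x
  adj-sym {x} {y} xy = trans (*-comm y x) xy

  adj-*ʳ : ∀ {v x} s → Adj v x → Adj v (x * s)
  adj-*ʳ {v} {x} s vx = trans (sym (*-assoc v x s)) (trans (*-congʳ vx) (zeroˡ s))

  adj-*ˡ : ∀ {v x} s → Adj v x → Adj v (s * x)
  adj-*ˡ {x = x} s vx = trans (*-congˡ (*-comm s x)) (adj-*ʳ s vx)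

  Dominates : Carrier → Carrier → Set ℓ
  Dominates x v = v ≈ x ⊎ Adj v x

  N[_] : List Carrier → Pred Carrier (c ⊔ˡ ℓ)
  N[ X ] v = Any (λ x → Dominates x v) X

  N⟨_⟩ : List Carrier → Pred Carrier (c ⊔ˡ ℓ)
  N⟨ Y ⟩ v = Any (Adj v) Y

  dominating⇒N[] : ∀ {X} → Dominating X → IsVertex ⊆ N[ X ]
  dominating⇒N[] (_ , dom) {v} vv with dom v vv
  ... | inj₁ v∈X = Any.map inj₁ v∈X
  ... | inj₂ v∼X = Any.map inj₂ v∼X

  totalDominating⇒dominating : ∀ {X} → TotalDominating X → Dominating X
  totalDominating⇒dominating (vs , total) = vs , λ v vv → inj₂ (total v vv)

  dominates⇒adj : ∀ {x y z v} → (Adj v x → Adj v y) → Adj x z → Dominates x v → Adj v y ⊎ Adj v z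
  dominates⇒adj _ xz (inj₁ v≈x) = inj₂ (adj-respˡ v≈x xz)
  dominates⇒adj f _ (inj₂ vx) = inj₁ (f vx)

  record Pairing (x e : Carrier) : Set (c ⊔ˡ ℓ) where
    constructor pairing
    field
      p q : Carrier
      p≉0 : ¬ p ≈ 0#
      q≉0 : ¬ q ≈ 0#
      adj-pq : Adj p q
      cover-x : ∀ {v} → Dominates x v → Adj v p ⊎ Adj v q
      cover-e : ∀ {v} → Dominates e v → Adj v p ⊎ Adj v q

    vertex-p : IsVertex p
    vertex-p = p≉0 , q , q≉0 , adj-pq

    vertex-q : IsVertex q
    vertex-q = q≉0 , p , p≉0 , adj-sym adj-pq

    cover : N[ x ∷ e ∷ [] ] ⊆ N⟨ p ∷ q ∷ [] ⟩
    cover (here d) = Sum.[ here , there ∘ here ]′ (cover-x d)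
    cover (there (here d)) = Sum.[ here , there ∘ here ]′ (cover-e d)

    cover-∷ : ∀ {M Y} → N[ p ∷ M ] ⊆ N⟨ Y ⟩ → N[ x ∷ e ∷ M ] ⊆ N⟨ q ∷ Y ⟩
    cover-∷ {Y = Y} cov d = Sum.[ via-pq ∘ cover , there ∘ cov ∘ there ]′ (Any.++⁻ (x ∷ e ∷ []) d)
      where
      via-pq : N⟨ p ∷ q ∷ [] ⟩ ⊆ N⟨ q ∷ Y ⟩
      via-pq (here vp) = there (cov (here (inj₂ vp)))
      via-pq (there (here vq)) = here vq

  ¬¬pairing : ∀ {x e} → IsVertex x → IsVertex e → ¬ ¬ Pairing x e
  ¬¬pairing {x} {e} (x≉0 , a , a≉0 , xa) (e≉0 , b , b≉0 , eb) = do
    xe? ← ¬¬-excluded-middle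
    xb? ← ¬¬-excluded-middle
    ea? ← ¬¬-excluded-middle
    return (choose xe? xb? ea?)
    where
    choose : Dec (Adj x e) → Dec (Adj x b) → Dec (Adj e a) → Pairing x e
    choose (yes xe) _ _ = pairing x e x≉0 e≉0 xe
      (dominates⇒adj id xe)
      (Sum.swap ∘ dominates⇒adj id (adj-sym xe))
    choose (no ¬xe) (yes xb) _ = pairing (x * e) b ¬xe b≉0 (adj-sym (adj-*ˡ x (adj-sym eb)))
      (dominates⇒adj (adj-*ʳ e) xb)
      (dominates⇒adj (adj-*ˡ x) eb)
    choose (no ¬xe) (no _) (yes ea) = pairing (x * e) a ¬xe a≉0 (adj-sym (adj-*ʳ e (adj-sym xa)))
      (dominates⇒adj (adj-*ʳ e) xa)
      (dominates⇒adj (adj-*ˡ x) ea)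
    choose (no _) (no ¬xb) (no ¬ea) = pairing (x * b) (e * a) ¬xb ¬ea
      (adj-sym (adj-*ʳ b (adj-sym (adj-*ˡ e xa))))
      (dominates⇒adj (adj-*ʳ b) (adj-*ˡ e xa))
      (Sum.swap ∘ dominates⇒adj (adj-*ʳ a) (adj-*ˡ x eb))

  ¬¬pairwiseCover : ∀ x e M → All IsVertex (x ∷ e ∷ M) →
    ¬ ¬ (∃ λ Y → All IsVertex Y × length Y ≡ length (x ∷ e ∷ M) × N[ x ∷ e ∷ M ] ⊆ N⟨ Y ⟩)
  ¬¬pairwiseCover x e [] (vx ∷ ve ∷ []) = do
    P ← ¬¬pairing vx ve
    let open Pairing P
    return (p ∷ q ∷ [] , vertex-p ∷ vertex-q ∷ [] , refl , λ {_} → cover)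
  ¬¬pairwiseCover x e (f ∷ M) (vx ∷ ve ∷ vfM) = do
    P ← ¬¬pairing vx ve
    let open Pairing P
    (Y , vsY , |Y|≡ , cov) ← ¬¬pairwiseCover p f M (vertex-p ∷ vfM)
    return (q ∷ Y , vertex-q ∷ vsY , cong suc |Y|≡ , λ {_} → cover-∷ cov)

  ¬¬openCover : ∀ X → All IsVertex X →
    ¬ ¬ (∃ λ Y → All IsVertex Y × length Y ≤ 2 ⊔ length X × N[ X ] ⊆ N⟨ Y ⟩)
  ¬¬openCover [] [] = return ([] , [] , z≤n , λ ())
  ¬¬openCover (x ∷ []) (vx@(x≉0 , a , a≉0 , xa) ∷ []) =
    return (x ∷ a ∷ [] , vx ∷ (a≉0 , x , x≉0 , adj-sym xa) ∷ [] , ≤-refl , λ {_} → cover)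
    where
    cover : N[ x ∷ [] ] ⊆ N⟨ x ∷ a ∷ [] ⟩
    cover (here (inj₁ v≈x)) = there (here (adj-respˡ v≈x xa))
    cover (here (inj₂ vx)) = here vx
  ¬¬openCover (x ∷ e ∷ M) vs =
    ¬¬-map (λ (Y , vsY , |Y|≡ , cov) → Y , vsY , ≤-reflexive |Y|≡ , λ {_} → cov)
           (¬¬pairwiseCover x e M vs)

  dominating⇒¬¬totalDominating : ∀ {X} → Dominating X →
    ¬ ¬ (∃ λ Y → TotalDominating Y × length Y ≤ 2 ⊔ length X)
  dominating⇒¬¬totalDominating {X} dom@(vs , _) =
    ¬¬-map (λ (Y , vsY , |Y|≤ , cov) → Y , (vsY , λ _ vv → cov (dominating⇒N[] dom vv)) , |Y|≤)
           (¬¬openCover X vs)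

  totalDominationNumber⇒dominationNumber : ∀ n → 2 < n →
    TotalDominationNumberIs n → DominationNumberIs n
  totalDominationNumber⇒dominationNumber n 2<n ((T , vsT , total , |T|≡n) , minimal) =
    (T , vsT , totalDominating⇒dominating total , |T|≡n) , minimalDominating
    where
    minimalDominating : ∀ X → Dominating X → n ≤ length X
    minimalDominating X dom = decidable-stable (n ≤? length X)
      (¬¬-map (λ (Y , totalY , |Y|≤) →
                 m≤n⊔o∧n<m⇒m≤o 2 (length X) (≤-trans (minimal Y totalY) |Y|≤) 2<n)
              (dominating⇒¬¬totalDominating dom))

theorem4p2 : {c ℓ : Level} (R : CommutativeRing c ℓ) (n : ℕ) → 4 ≤ n →
    ZeroDivisorGraph.TotalDominationNumberIs R n →
    ZeroDivisorGraph.DominationNumberIs R n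
theorem4p2 R n 4≤n = totalDominationNumber⇒dominationNumber R n (≤-trans (n≤1+n 3) 4≤n)
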